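{- Let $A$ be an inhabited set with decidable equality and $\mathcal A$ the ideal completion of $(A^*,\preceq)$. The map $\iota:A^{\mathbb N}\to\mathcal A$, $\iota(\alpha)=\{\tau\in A^*\mid\tau\text{ is an initial segment of }\alpha\}$, is a homeomorphism from $A^{\mathbb N}$ (with the product topology of discrete spaces) onto the subspace of strongly maximal elements of $\mathcal A$ with the relative Scott topology. Moreover, for all $\alpha,\beta\in A^{\mathbb N}$, $\alpha\#_{\mathbf A}\beta$ if and only if $\iota(\alpha)\#\iota(\beta)$.
   Context: We work constructively: informal set theory without excluded middle or choice. $A^*$ is the set of finite sequences on $A$ ordered by prefix $\preceq$; its ideal completion $\mathcal A$ is the set of subsets of $A^*$ that are lower sets and directed (inhabited, any two elements have a common extension in the subset), ordered by inclusion (directed suprema are unions). Basic opens of $A^{\mathbb N}$ are $\{\alpha\mid\sigma\text{ is an initial segment of }\alpha\}$ for $\sigma\in A^*$. For $\alpha\in A^{\mathbb N}$ let $\bar\alpha_n$ be its first $n$ entries; $\alpha\#_{\mathbf A}\beta$ means there is $n$ with $\bar\alpha_n\neq\bar\beta_n$. In a dcpo, $x\ll y$ if for every directed $S$ with $y\sqsubseteq\bigsqcup S$ some $s\in S$ has $x\sqsubseteq s$; Scott open sets are upper sets $U$ such that $\bigsqcup S\in U$ for directed $S$ implies some $s\in S$ is in $U$. An element $x$ is strongly maximal if for all $u\ll v$, $u\ll x$ or there are disjoint Scott opens containing $v$ and $x$ respectively. The intrinsic apartness: $x\# y$ iff some Scott open contains exactly one of $x,y$. -}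

module Defs where

open import Data.Nat using (ℕ; zero; suc)
open import Data.List using (List; []; _∷_)
open import Data.Product using (Σ; _×_; _,_; proj₁; proj₂)
open import Data.Sum using (_⊎_; inj₁; inj₂)
open import Data.Unit using (⊤; tt)
open import Data.Empty using (⊥)
open import Relation.Nullary using (¬_)
open import Relation.Binary.PropositionalEquality using (_≡_; refl; sym; trans; cong)
open import Function using (_∘_)

_↔_ : ∀ {a b} → Set a → Set b → Set _
P ↔ Q = (P → Q) × (Q → P)

data _≼_ {A : Set} : List A → List A → Set where
  []≼ : ∀ {τ} → [] ≼ τ
  ∷≼  : ∀ {a σ τ} → σ ≼ τ → (a ∷ σ) ≼ (a ∷ τ)

bar : {A : Set} → (ℕ → A) → ℕ → List A
bar α zero    = []
bar α (suc n) = α 0 ∷ bar (α ∘ suc) n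

InitSeg : {A : Set} → List A → (ℕ → A) → Set
InitSeg []      α = ⊤
InitSeg (a ∷ τ) α = (a ≡ α 0) × InitSeg τ (α ∘ suc)

-- open sets of the product topology of discrete spaces:
-- unions of basic opens {α | σ initial segment of α}
IsOpenℕ : {A : Set} → ((ℕ → A) → Set) → Set
IsOpenℕ {A} V = ∀ α → V α →
  Σ (List A) λ σ → InitSeg σ α × (∀ β → InitSeg σ β → V β)

_#A_ : {A : Set} → (ℕ → A) → (ℕ → A) → Set
α #A β = Σ ℕ λ n → ¬ (bar α n ≡ bar β n)

record Ideal (A : Set) : Set₁ where
  field
    carrier   : List A → Set
    lower     : ∀ {σ τ} → σ ≼ τ → carrier τ → carrier σ
    inhabited : Σ (List A) carrier
    directed  : ∀ {σ τ} → carrier σ → carrier τ →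
                Σ (List A) λ ρ → σ ≼ ρ × τ ≼ ρ × carrier ρ
open Ideal public

_⊑_ : {A : Set} → Ideal A → Ideal A → Set
x ⊑ y = ∀ τ → carrier x τ → carrier y τ

_≈_ : {A : Set} → Ideal A → Ideal A → Set
x ≈ y = (x ⊑ y) × (y ⊑ x)

record DirFam (A : Set) : Set₁ where
  field
    Idx   : Set
    fam   : Idx → Ideal A
    inh   : Idx
    ub    : ∀ i j → Σ Idx λ k → fam i ⊑ fam k × fam j ⊑ fam k
open DirFam public

⋁ : {A : Set} → DirFam A → Ideal A
⋁ {A} D = record
  { carrier   = λ τ → Σ (Idx D) λ i → carrier (fam D i) τ
  ; lower     = λ p (i , t) → i , lower (fam D i) p t
  ; inhabited = let (τ , t) = inhabited (fam D (inh D)) in τ , inh D , t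
  ; directed  = dir
  }
  where
  dir : ∀ {σ τ} → Σ (Idx D) (λ i → carrier (fam D i) σ) →
        Σ (Idx D) (λ i → carrier (fam D i) τ) →
        Σ (List A) λ ρ → σ ≼ ρ × τ ≼ ρ × Σ (Idx D) (λ i → carrier (fam D i) ρ)
  dir {σ} {τ} (i , s) (j , t) with ub D i j
  ... | k , ik , jk with directed (fam D k) (ik σ s) (jk τ t)
  ... | ρ , p , q , r = ρ , p , q , k , r

_≪_ : {A : Set} → Ideal A → Ideal A → Set₁
_≪_ {A} x y = (D : DirFam A) → y ⊑ ⋁ D → Σ (Idx D) λ i → x ⊑ fam D i

record ScottOpen {A : Set} (U : Ideal A → Set) : Set₁ where
  field
    upper        : ∀ x y → x ⊑ y → U x → U y
    inaccessible : (D : DirFam A) → U (⋁ D) → Σ (Idx D) λ i → U (fam D i)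

Disjoint : {A : Set} → (Ideal A → Set) → (Ideal A → Set) → Set₁
Disjoint {A} U V = (x : Ideal A) → U x → V x → ⊥

StronglyMaximal : {A : Set} → Ideal A → Set₁
StronglyMaximal {A} x = (u v : Ideal A) → u ≪ v →
  (u ≪ x) ⊎
  Σ (Ideal A → Set) λ U → Σ (Ideal A → Set) λ V →
    ScottOpen U × ScottOpen V × Disjoint U V × U v × V x

_#_ : {A : Set} → Ideal A → Ideal A → Set₁
_#_ {A} x y = Σ (Ideal A → Set) λ U →
  ScottOpen U × ((U x × ¬ U y) ⊎ (U y × ¬ U x))

private
  init-lower : {A : Set} (α : ℕ → A) {σ τ : List A} →
               σ ≼ τ → InitSeg τ α → InitSeg σ α
  init-lower α []≼ t = tt
  init-lower α (∷≼ p) (e , t) = e , init-lower (α ∘ suc) p t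

  init-total : {A : Set} (α : ℕ → A) (σ τ : List A) →
               InitSeg σ α → InitSeg τ α → (σ ≼ τ) ⊎ (τ ≼ σ)
  init-total α [] τ s t = inj₁ []≼
  init-total α (a ∷ σ) [] s t = inj₂ []≼
  init-total α (a ∷ σ) (b ∷ τ) (e , s) (f , t) with trans e (sym f)
  ... | refl with init-total (α ∘ suc) σ τ s t
  ... | inj₁ p = inj₁ (∷≼ p)
  ... | inj₂ p = inj₂ (∷≼ p)

  ≼-refl : {A : Set} (σ : List A) → σ ≼ σ
  ≼-refl [] = []≼
  ≼-refl (a ∷ σ) = ∷≼ (≼-refl σ)

ι : {A : Set} → (ℕ → A) → Ideal A
ι {A} α = record
  { carrier   = λ τ → InitSeg τ α
  ; lower     = init-lower α
  ; inhabited = [] , tt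
  ; directed  = dir
  }
  where
  dir : ∀ {σ τ} → InitSeg σ α → InitSeg τ α →
        Σ (List A) λ ρ → σ ≼ ρ × τ ≼ ρ × InitSeg ρ α
  dir {σ} {τ} s t with init-total α σ τ s t
  ... | inj₁ p = τ , p , ≼-refl τ , t
  ... | inj₂ p = σ , ≼-refl σ , p , s

-- Every ideal is the directed union of the principal ideals ↓σ of its members, and each ↓σ is
-- compact, so Scott opens are unions of the basic opens ↑σ = {x | σ ∈ x}; under ι these
-- pull back to the basic opens of A^ℕ, which gives continuity, openness and the apartness
-- correspondence. ι α is strongly maximal because, by decidability of equality, an approximant
-- σ of v either is an initial segment of α or is separated from α by ↑σ and ↑(ᾱ|σ|).
-- Conversely, testing strong maximality of x against u = v = ↓(σ a) shows that every member σ
-- of x has a strictly longer one, and the members of an ideal, being pairwise compatible, are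
-- then the initial segments of a single α.
module Submission where

open import Defs
open import Data.Nat using (ℕ; zero; suc; _≤_; _<_; z≤n; s≤s; _<?_)
open import Data.Nat.Properties using (≤-trans; ≮⇒≥; suc-injective; m<m+n; m≤n⇒m⊓n≡m)
open import Data.List using (List; []; _∷_; _++_; length; take)
open import Data.List.Properties using (length-++; length-take)
open import Data.Product using (Σ; _×_; _,_; proj₁; proj₂)
open import Data.Sum using (inj₁; inj₂)
open import Data.Unit using (tt)
open import Data.Empty using (⊥; ⊥-elim)
open import Relation.Nullary using (¬_; yes; no; Dec)
open import Relation.Binary.PropositionalEquality using (_≡_; _≗_; refl; sym; trans; cong; cong₂; subst)
open import Relation.Binary.Definitions using (DecidableEquality)
open import Function using (_∘_)

module _ {A : Set} where
  open ScottOpen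

  ≼-refl : (σ : List A) → σ ≼ σ
  ≼-refl []      = []≼
  ≼-refl (a ∷ σ) = ∷≼ (≼-refl σ)

  ≼-trans : {σ τ ρ : List A} → σ ≼ τ → τ ≼ ρ → σ ≼ ρ
  ≼-trans []≼    q      = []≼
  ≼-trans (∷≼ p) (∷≼ q) = ∷≼ (≼-trans p q)

  ≼-++ : (σ τ : List A) → σ ≼ (σ ++ τ)
  ≼-++ []      τ = []≼
  ≼-++ (a ∷ σ) τ = ∷≼ (≼-++ σ τ)

  take-≼ : (n : ℕ) (ρ : List A) → take n ρ ≼ ρ
  take-≼ zero    ρ       = []≼
  take-≼ (suc n) []      = []≼
  take-≼ (suc n) (a ∷ ρ) = ∷≼ (take-≼ n ρ)

  ≼-≤-length⇒≼ : {σ τ ρ : List A} → σ ≼ ρ → τ ≼ ρ → length τ ≤ length σ → τ ≼ σ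
  ≼-≤-length⇒≼ p      []≼    _         = []≼
  ≼-≤-length⇒≼ (∷≼ p) (∷≼ q) (s≤s le) = ∷≼ (≼-≤-length⇒≼ p q le)

  ≼-≡-length⇒≡ : {σ τ ρ : List A} → σ ≼ ρ → τ ≼ ρ → length σ ≡ length τ → σ ≡ τ
  ≼-≡-length⇒≡ []≼         []≼    _ = refl
  ≼-≡-length⇒≡ (∷≼ {a} p) (∷≼ q) e = cong (a ∷_) (≼-≡-length⇒≡ p q (suc-injective e))

  ↓ : List A → Ideal A
  ↓ σ = record
    { carrier   = _≼ σ
    ; lower     = ≼-trans
    ; inhabited = [] , []≼
    ; directed  = λ p q → σ , p , q , ≼-refl σ
    }

  ↓-⊑ : (x : Ideal A) {σ : List A} → carrier x σ → ↓ σ ⊑ x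
  ↓-⊑ x s τ p = lower x p s

  principals : Ideal A → DirFam A
  principals x = record
    { Idx = Σ (List A) (carrier x)
    ; fam = ↓ ∘ proj₁
    ; inh = inhabited x
    ; ub  = upperBound
    }
    where
    upperBound : (i j : Σ (List A) (carrier x)) → Σ (Σ (List A) (carrier x)) λ k →
                 ↓ (proj₁ i) ⊑ ↓ (proj₁ k) × ↓ (proj₁ j) ⊑ ↓ (proj₁ k)
    upperBound (σ , s) (τ , t) with directed x s t
    ... | ρ , p , q , r = (ρ , r) , (λ _ h → ≼-trans h p) , (λ _ h → ≼-trans h q)

  ⊑-⋁-principals : (x : Ideal A) → x ⊑ ⋁ (principals x)
  ⊑-⋁-principals x τ t = (τ , t) , ≼-refl τ

  ⊑-≪-trans : (u v x : Ideal A) → u ⊑ v → v ≪ x → u ≪ x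
  ⊑-≪-trans u v x u⊑v v≪x D x⊑⋁D with v≪x D x⊑⋁D
  ... | i , v⊑i = i , λ τ t → v⊑i τ (u⊑v τ t)

  ∈⇒↓≪ : (x : Ideal A) {σ : List A} → carrier x σ → ↓ σ ≪ x
  ∈⇒↓≪ x {σ} s D x⊑⋁D with x⊑⋁D σ s
  ... | i , c = i , ↓-⊑ (fam D i) c

  ≪-approximated : (u v : Ideal A) → u ≪ v → Σ (List A) λ σ → carrier v σ × u ⊑ ↓ σ
  ≪-approximated u v u≪v with u≪v (principals v) (⊑-⋁-principals v)
  ... | (σ , s) , u⊑↓σ = σ , s , u⊑↓σ

  ↓≪⇒∈ : (x : Ideal A) {σ : List A} → ↓ σ ≪ x → carrier x σ
  ↓≪⇒∈ x {σ} w with ≪-approximated (↓ σ) x w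
  ... | τ , t , ↓σ⊑↓τ = lower x (↓σ⊑↓τ σ (≼-refl σ)) t

  ↑ : List A → Ideal A → Set
  ↑ σ x = carrier x σ

  ↑-scottOpen : (σ : List A) → ScottOpen (↑ σ)
  ↑-scottOpen σ = record { upper = λ _ _ x⊑y s → x⊑y σ s ; inaccessible = λ _ s → s }

  ↑-disjoint : {σ τ : List A} → (∀ ρ → σ ≼ ρ → τ ≼ ρ → ⊥) → Disjoint (↑ σ) (↑ τ)
  ↑-disjoint incompatible x s t with directed x s t
  ... | ρ , p , q , _ = incompatible ρ p q

  scottOpen-principal : {U : Ideal A → Set} → ScottOpen U → (x : Ideal A) → U x →
                        Σ (List A) λ σ → carrier x σ × U (↓ σ)
  scottOpen-principal oU x u
    with inaccessible oU (principals x) (upper oU _ _ (⊑-⋁-principals x) u)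
  ... | (σ , s) , u↓σ = σ , s , u↓σ

  bar-initSeg : (α : ℕ → A) (n : ℕ) → InitSeg (bar α n) α
  bar-initSeg α zero    = tt
  bar-initSeg α (suc n) = refl , bar-initSeg (α ∘ suc) n

  length-bar : (α : ℕ → A) (n : ℕ) → length (bar α n) ≡ n
  length-bar α zero    = refl
  length-bar α (suc n) = cong suc (length-bar (α ∘ suc) n)

  initSeg⇒≡bar : {α : ℕ → A} (σ : List A) → InitSeg σ α → σ ≡ bar α (length σ)
  initSeg⇒≡bar []      _       = refl
  initSeg⇒≡bar (a ∷ σ) (e , s) = cong₂ _∷_ e (initSeg⇒≡bar σ s)

  ≡bar⇒initSeg : {α : ℕ → A} {σ : List A} {n : ℕ} → σ ≡ bar α n → InitSeg σ α
  ≡bar⇒initSeg {α} {n = n} refl = bar-initSeg α n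

  initSeg-length-unique : {α : ℕ → A} {σ τ : List A} → InitSeg σ α → InitSeg τ α →
                          length σ ≡ length τ → σ ≡ τ
  initSeg-length-unique {α} {σ} {τ} s t e =
    trans (initSeg⇒≡bar σ s) (trans (cong (bar α) e) (sym (initSeg⇒≡bar τ t)))

  initSeg-transport : {α β : ℕ → A} {σ : List A} → InitSeg σ α →
                      bar α (length σ) ≡ bar β (length σ) → InitSeg σ β
  initSeg-transport {σ = σ} s e = ≡bar⇒initSeg (trans (initSeg⇒≡bar σ s) e)

  bar-suc-initSeg⇒≡ : (α β : ℕ → A) (n : ℕ) → InitSeg (bar α (suc n)) β → α n ≡ β n
  bar-suc-initSeg⇒≡ α β zero    (e , _) = e
  bar-suc-initSeg⇒≡ α β (suc n) (_ , t) = bar-suc-initSeg⇒≡ (α ∘ suc) (β ∘ suc) n t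

  ι-injective : (α β : ℕ → A) → ι α ⊑ ι β → α ≗ β
  ι-injective α β ια⊑ιβ n = bar-suc-initSeg⇒≡ α β n (ια⊑ιβ _ (bar-initSeg α (suc n)))

  ι-continuous : (U : Ideal A → Set) → ScottOpen U → IsOpenℕ (λ α → U (ι α))
  ι-continuous U oU α u with scottOpen-principal oU (ι α) u
  ... | σ , s , u↓σ = σ , s , λ β t → upper oU (↓ σ) (ι β) (↓-⊑ (ι β) t) u↓σ

  initSeg? : DecidableEquality A → (σ : List A) (α : ℕ → A) → Dec (InitSeg σ α)
  initSeg? _≟_ []      α = yes tt
  initSeg? _≟_ (a ∷ σ) α with a ≟ α 0 | initSeg? _≟_ σ (α ∘ suc)
  ... | yes e | yes s = yes (e , s)
  ... | no ¬e | _     = no (¬e ∘ proj₁)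
  ... | yes _ | no ¬s = no (¬s ∘ proj₂)

  ι-stronglyMaximal : DecidableEquality A → (α : ℕ → A) → StronglyMaximal (ι α)
  ι-stronglyMaximal _≟_ α u v u≪v with ≪-approximated u v u≪v
  ... | σ , σ∈v , u⊑↓σ with initSeg? _≟_ σ α
  ... | yes σ∈ια = inj₁ (⊑-≪-trans u (↓ σ) (ι α) u⊑↓σ (∈⇒↓≪ (ι α) σ∈ια))
  ... | no σ∉ια = inj₂ ( ↑ σ , ↑ (bar α (length σ)) , ↑-scottOpen σ , ↑-scottOpen _
                       , ↑-disjoint incompatible , σ∈v , bar-initSeg α (length σ))
    where
    incompatible : ∀ ρ → σ ≼ ρ → bar α (length σ) ≼ ρ → ⊥
    incompatible ρ p q = σ∉ια (≡bar⇒initSeg (≼-≡-length⇒≡ p q (sym (length-bar α (length σ)))))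

  Unbounded : Ideal A → Set
  Unbounded x = ∀ n → Σ (List A) λ τ → carrier x τ × n ≤ length τ

  stronglyMaximal⇒longer : A → (x : Ideal A) → StronglyMaximal x → {σ : List A} → carrier x σ →
                           Σ (List A) λ τ → carrier x τ × length σ < length τ
  stronglyMaximal⇒longer a x sm {σ} s
    with sm (↓ ρ) (↓ ρ) (∈⇒↓≪ (↓ ρ) (≼-refl ρ))
    where ρ = σ ++ a ∷ []
  ... | inj₁ ↓ρ≪x =
    σ ++ a ∷ [] , ↓≪⇒∈ x ↓ρ≪x , subst (length σ <_) (sym (length-++ σ)) (m<m+n _ (s≤s z≤n))
  ... | inj₂ (U , V , _ , oV , disjoint , U↓ρ , Vx) with scottOpen-principal oV x Vx
  ... | τ , t , V↓τ with length σ <? length τ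
  ... | yes longer = τ , t , longer
  ... | no ¬longer with directed x s t
  ... | _ , p , q , _ = ⊥-elim (disjoint (↓ (σ ++ a ∷ [])) U↓ρ (upper oV (↓ τ) _ ↓τ⊑↓ρ V↓τ))
    where
    ↓τ⊑↓ρ : ↓ τ ⊑ ↓ (σ ++ a ∷ [])
    ↓τ⊑↓ρ _ k = ≼-trans k (≼-trans (≼-≤-length⇒≼ p q (≮⇒≥ ¬longer)) (≼-++ σ _))

  stronglyMaximal⇒unbounded : A → (x : Ideal A) → StronglyMaximal x → Unbounded x
  stronglyMaximal⇒unbounded a x sm zero = proj₁ (inhabited x) , proj₂ (inhabited x) , z≤n
  stronglyMaximal⇒unbounded a x sm (suc n) with stronglyMaximal⇒unbounded a x sm n
  ... | σ , s , n≤σ with stronglyMaximal⇒longer a x sm s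
  ... | τ , t , σ<τ = τ , t , ≤-trans (s≤s n≤σ) σ<τ

  nth : A → List A → ℕ → A
  nth a []      _       = a
  nth a (b ∷ σ) zero    = b
  nth a (b ∷ σ) (suc i) = nth a σ i

  nth-≼ : (a : A) {σ ρ : List A} (i : ℕ) → σ ≼ ρ → i < length σ → nth a σ i ≡ nth a ρ i
  nth-≼ a zero    (∷≼ p) _          = refl
  nth-≼ a (suc i) (∷≼ p) (s≤s i<σ) = nth-≼ a i p i<σ

  members-agree : (a : A) (x : Ideal A) {σ τ : List A} → carrier x σ → carrier x τ →
                  (i : ℕ) → i < length σ → i < length τ → nth a σ i ≡ nth a τ i
  members-agree a x s t i i<σ i<τ with directed x s t
  ... | _ , p , q , _ = trans (nth-≼ a i p i<σ) (sym (nth-≼ a i q i<τ))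

  nth⇒initSeg : (a : A) (β : ℕ → A) (ρ : List A) →
                (∀ i → i < length ρ → nth a ρ i ≡ β i) → InitSeg ρ β
  nth⇒initSeg a β []      _ = tt
  nth⇒initSeg a β (b ∷ ρ) h = h 0 (s≤s z≤n) , nth⇒initSeg a (β ∘ suc) ρ (λ i → h (suc i) ∘ s≤s)

  -- The default a of nth is never read: limit n is taken from a member of length > n.
  unbounded⇒≈ι : A → (x : Ideal A) → Unbounded x → Σ (ℕ → A) λ α → ι α ≈ x
  unbounded⇒≈ι a x unbounded = limit , ι-limit⊑x , x⊑ι-limit
    where
    limit : ℕ → A
    limit n = nth a (proj₁ (unbounded (suc n))) n

    x⊑ι-limit : x ⊑ ι limit
    x⊑ι-limit τ t = nth⇒initSeg a limit τ λ i i<τ →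
      let (_ , r , i<ρ) = unbounded (suc i) in members-agree a x t r i i<τ i<ρ

    ι-limit⊑x : ι limit ⊑ x
    ι-limit⊑x τ τ∈ι with unbounded (length τ)
    ... | ρ , r , τ≤ρ = subst (carrier x) prefix≡τ prefix∈x
      where
      prefix∈x : carrier x (take (length τ) ρ)
      prefix∈x = lower x (take-≼ (length τ) ρ) r
      prefix≡τ : take (length τ) ρ ≡ τ
      prefix≡τ = initSeg-length-unique (x⊑ι-limit _ prefix∈x) τ∈ι
                   (trans (length-take (length τ) ρ) (m≤n⇒m⊓n≡m τ≤ρ))

  basicUnion : ((ℕ → A) → Set) → Ideal A → Set
  basicUnion V x = Σ (List A) λ σ → carrier x σ × (∀ β → InitSeg σ β → V β)

  basicUnion-scottOpen : (V : (ℕ → A) → Set) → ScottOpen (basicUnion V)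
  basicUnion-scottOpen V = record
    { upper        = λ _ _ x⊑y (σ , s , h) → σ , x⊑y σ s , h
    ; inaccessible = λ _ (σ , (i , s) , h) → i , σ , s , h
    }

  basicUnion-≈ι : (V : (ℕ → A) → Set) → IsOpenℕ V → (x : Ideal A) → Σ (ℕ → A) (λ α → ι α ≈ x) →
                  basicUnion V x ↔ Σ (ℕ → A) λ α → V α × ι α ≈ x
  basicUnion-≈ι V oV x (α , ια≈x) = to , from
    where
    to : basicUnion V x → Σ (ℕ → A) λ α → V α × ι α ≈ x
    to (σ , s , h) = α , h α (proj₂ ια≈x σ s) , ια≈x
    from : (Σ (ℕ → A) λ α → V α × ι α ≈ x) → basicUnion V x
    from (β , Vβ , ιβ≈x) with oV β Vβ
    ... | σ , s , h = σ , proj₁ ιβ≈x σ s , h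

  #A-sym : {α β : ℕ → A} → α #A β → β #A α
  #A-sym (n , ≢) = n , ≢ ∘ sym

  #A⇒ι# : (α β : ℕ → A) → α #A β → ι α # ι β
  #A⇒ι# α β (n , ≢) = ↑ (bar α n) , ↑-scottOpen (bar α n) , inj₁ (bar-initSeg α n , ¬initSeg)
    where
    ¬initSeg : ¬ InitSeg (bar α n) β
    ¬initSeg t = ≢ (trans (initSeg⇒≡bar (bar α n) t) (cong (bar β) (length-bar α n)))

  separated⇒#A : {U : Ideal A → Set} → ScottOpen U → (α β : ℕ → A) → U (ι α) → ¬ U (ι β) → α #A β
  separated⇒#A {U} oU α β Uια ¬Uιβ with ι-continuous U oU α Uια
  ... | σ , s , h = length σ , λ e → ¬Uιβ (h β (initSeg-transport s e))

  ι#⇒#A : (α β : ℕ → A) → ι α # ι β → α #A β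
  ι#⇒#A α β (U , oU , inj₁ (Uια , ¬Uιβ)) = separated⇒#A oU α β Uια ¬Uιβ
  ι#⇒#A α β (U , oU , inj₂ (Uιβ , ¬Uια)) = #A-sym (separated⇒#A oU β α Uιβ ¬Uια)

theorem7p9 : (A : Set) → A → DecidableEquality A →
    ((α : ℕ → A) → StronglyMaximal (ι α))
    × ((x : Ideal A) → StronglyMaximal x → Σ (ℕ → A) λ α → ι α ≈ x)
    × ((α β : ℕ → A) → ι α ≈ ι β → (n : ℕ) → α n ≡ β n)
    × ((U : Ideal A → Set) → ScottOpen U → IsOpenℕ (λ α → U (ι α)))
    × ((V : (ℕ → A) → Set) → IsOpenℕ V →
         Σ (Ideal A → Set) λ U → ScottOpen U ×
           ((x : Ideal A) → StronglyMaximal x → U x ↔ Σ (ℕ → A) λ α → V α × ι α ≈ x))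
    × ((α β : ℕ → A) → (α #A β) ↔ (ι α # ι β))
theorem7p9 A a _≟_ =
    ι-stronglyMaximal _≟_
  , surjective
  , (λ α β ια≈ιβ → ι-injective α β (proj₁ ια≈ιβ))
  , ι-continuous
  , (λ V oV → basicUnion V , basicUnion-scottOpen V ,
       λ x sm → basicUnion-≈ι V oV x (surjective x sm))
  , (λ α β → #A⇒ι# α β , ι#⇒#A α β)
  where
  surjective : (x : Ideal A) → StronglyMaximal x → Σ (ℕ → A) λ α → ι α ≈ x
  surjective x sm = unbounded⇒≈ι a x (stronglyMaximal⇒unbounded a x sm)
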